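{- Let $T$ be a $\beta(1,0)$-tree in which every node other than the root has a sibling. Then the rooted non-separable planar map $\Phi(T)$ corresponding to $T$ under the Cori–Jacquard–Schaeffer bijection has no multiple edges.
   Context: A rooted non-separable planar map is a planar map with no loops and no cut vertices, with a distinguished directed root edge; the root face (face to the right of the root edge) is assumed to be the outer face. A $\beta(1,0)$-tree is a rooted plane tree with positive integer labels such that every leaf has label $1$, the root has label equal to the sum of its children's labels, and every other internal node has label at most the sum of its children's labels. Two nodes are siblings if they have the same parent. The bijection $\Phi$: for each node $v$ define recursively a map $M(v)$ with two distinguished outer vertices, a root vertex $R$ and a marked vertex $\star$. If $v$ is a leaf, $M(v)$ is a single edge directed from $R$ to $\star$. If $v$ has label $i$ and children $u_1,\dots,u_m$ from left to right, identify $\star$ of $M(u_j)$ with $R$ of $M(u_{j+1})$ for $j<m$, then add in the outer face a new edge directed from $\star$ of $M(u_m)$ to $R$ of $M(u_1)$, which becomes the root edge, its tail being the new $R$; then (unless $v$ is the root) mark as $\star$ the $i$-th vertex counterclockwise around the outer face from, but not counting, $R$. $\Phi(T)=M(\text{root})$. -}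

module Defs where

open import Data.Nat using (ℕ; zero; suc; _+_; _≤_; _≡ᵇ_)
open import Data.Bool using (if_then_else_)
open import Data.List using (List; []; _∷_; _++_; map; take; drop; length)
open import Data.Nat.ListAction using (sum)
open import Data.List.Relation.Unary.All using (All)
open import Data.Product using (_×_; _,_; proj₁; proj₂)
open import Data.Sum using (_⊎_)
open import Data.Fin using (Fin)
open import Relation.Binary.PropositionalEquality using (_≡_; _≢_)
open import Relation.Nullary using (¬_)

data Tree : Set where
  node : ℕ → List Tree → Tree   -- label, children from left to right

label : Tree → ℕ
label (node i _) = i

children : Tree → List Tree
children (node _ cs) = cs

sumLabels : List Tree → ℕ
sumLabels cs = sum (map label cs)

data NonRootOK : Tree → Set where
  leafOK : ∀ {i} → i ≡ 1 → NonRootOK (node i [])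
  innerOK : ∀ {i c cs} → 1 ≤ i → i ≤ sumLabels (c ∷ cs) →
            All NonRootOK (c ∷ cs) → NonRootOK (node i (c ∷ cs))

-- β(1,0)-tree: positive labels, leaves labelled 1, root label = sum of
-- children's labels, other internal nodes label ≤ sum of children's labels.
data IsBeta10 : Tree → Set where
  rootOK : ∀ {i cs} → 1 ≤ i → i ≡ sumLabels cs → (cs ≡ [] → i ≡ 1) →
           All NonRootOK cs → IsBeta10 (node i cs)

-- Every non-root node has a sibling: whenever a node has children,
-- it has at least two of them.
data EveryNonRootHasSibling : Tree → Set where
  sib : ∀ {i cs} → (cs ≢ [] → 2 ≤ length cs) →
        All EveryNonRootHasSibling cs → EveryNonRootHasSibling (node i cs)

-- Vertices are natural numbers < size.  Edges are directed (tail , head).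
-- arc is the path along the outer face, counterclockwise, from the
-- root vertex R to the marked vertex ⋆ (both included), so
-- R = first element of arc and ⋆ = last element of arc.

record BMap : Set where
  constructor bmap
  field
    size  : ℕ
    edges : List (ℕ × ℕ)
    arc   : List ℕ
open BMap public

headD : List ℕ → ℕ
headD []      = 0
headD (x ∷ _) = x

lastD : List ℕ → ℕ
lastD []          = 0
lastD (x ∷ [])    = x
lastD (_ ∷ y ∷ ys) = lastD (y ∷ ys)

dropLast : List ℕ → List ℕ
dropLast []           = []
dropLast (x ∷ [])     = []
dropLast (x ∷ y ∷ ys) = x ∷ dropLast (y ∷ ys)

leafMap : BMap
leafMap = bmap 2 ((0 , 1) ∷ []) (0 ∷ 1 ∷ [])

-- Identify ⋆ of m₁ with R of m₂ (vertices of m₂ are shifted to be fresh).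
-- The resulting arc is the outer boundary path from R of m₁ to ⋆ of m₂.
glue : BMap → BMap → BMap
glue m₁ m₂ = bmap (size m₁ + size m₂)
                  (edges m₁ ++ map (λ e → f (proj₁ e) , f (proj₂ e)) (edges m₂))
                  (arc m₁ ++ map f (drop 1 (arc m₂)))
  where
  f : ℕ → ℕ
  f x = if x ≡ᵇ headD (arc m₂) then lastD (arc m₁) else size m₁ + x

-- Given the chain M(u₁)…M(uₘ) (arc = path R(u₁) … ⋆(uₘ)) and label i:
-- add the root edge ⋆(uₘ) → R(u₁) in the outer face (so the outer face
-- lies to its right); the new root R is ⋆(uₘ); counterclockwise around
-- the outer face from R one meets R(u₁), …, ⋆(uₘ) = R, and the new ⋆ is
-- the i-th vertex of this sequence, not counting R.
close : ℕ → BMap → BMap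
close i m = bmap (size m)
                 ((lastD (arc m) , headD (arc m)) ∷ edges m)
                 (lastD (arc m) ∷ take i (dropLast (arc m)))

mutual
  M : Tree → BMap
  M (node i [])       = leafMap
  M (node i (c ∷ cs)) = close i (chain (M c) cs)

  chain : BMap → List Tree → BMap
  chain acc []       = acc
  chain acc (c ∷ cs) = chain (glue acc (M c)) cs

-- Φ(T) : the (directed) edges of the map M(root).  (At the root the
-- marking ⋆ is computed but irrelevant.)
Φ : Tree → List (ℕ × ℕ)
Φ T = edges (M T)

Parallel : ℕ × ℕ → ℕ × ℕ → Set
Parallel (a , b) (c , d) = (a ≡ c × b ≡ d) ⊎ (a ≡ d × b ≡ c)

NoMultipleEdges : List (ℕ × ℕ) → Set
NoMultipleEdges es = (p q : Fin (length es)) → p ≢ q →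
                     ¬ Parallel (Data.List.lookup es p) (Data.List.lookup es q)

module Submission where

-- Call a map *simple* when its vertices are numbered below its
-- size, its edges are loopless and pairwise non-parallel, and its boundary
-- arc from R to ⋆ is a path of at least two distinct vertices.  Leaves give
-- simple maps, and gluing two simple maps keeps the result simple: the
-- second map is renamed injectively onto fresh vertices, except that its
-- root R₂ is sent to ⋆₁, so no old edge is duplicated.  The delicate step
-- is `close`, which adds the edge ⋆ → R; it is new exactly when R and ⋆
-- are not already adjacent.  This holds as soon as at least one gluing has
-- taken place: then R lies in the first piece and ⋆ among the fresh
-- vertices of the last one, and no edge joins these two parts.  The sibling
-- hypothesis guarantees that every internal node has at least two
-- children, hence that every `close` follows a gluing; positivity of the
-- labels keeps the boundary arc of length at least two.

open import Defs
open import Data.Nat using (ℕ; suc; _+_; _≤_; _<_; _≡ᵇ_; s≤s; z≤n; z<s)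
open import Data.Nat.Properties
  using (≡ᵇ⇒≡; ≡⇒≡ᵇ; +-cancelˡ-≡; m≤m+n; +-monoʳ-<; <-≤-trans; <⇒≱)
open import Data.Bool using (true; false; T; if_then_else_)
open import Data.Unit using (tt)
open import Data.Empty using (⊥-elim)
open import Data.List using (List; []; _∷_; _++_; map; lookup; length)
open import Data.List.Relation.Unary.All as All using (All; []; _∷_)
import Data.List.Relation.Unary.All.Properties as AllProps
open import Data.List.Relation.Unary.AllPairs as AllPairs using (AllPairs; []; _∷_)
import Data.List.Relation.Unary.AllPairs.Properties as AllPairsProps
open import Data.List.Membership.Propositional.Properties using (∈-lookup)
open import Data.Product using (_×_; _,_; proj₁; proj₂)
open import Data.Sum using (_⊎_; inj₁; inj₂)
open import Data.Fin using (Fin; zero; suc)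
open import Function using (_∘_)
open import Relation.Binary.Definitions using (Symmetric)
open import Relation.Binary.PropositionalEquality
  using (_≡_; _≢_; refl; sym; trans; cong; subst; ≢-sym)
open import Relation.Nullary using (¬_)

NonParallel : ℕ × ℕ → ℕ × ℕ → Set
NonParallel e e′ = ¬ Parallel e e′

NonParallel-sym : Symmetric NonParallel
NonParallel-sym {a , b} {c , d} np (inj₁ (c≡a , d≡b)) = np (inj₁ (sym c≡a , sym d≡b))
NonParallel-sym {a , b} {c , d} np (inj₂ (c≡b , d≡a)) = np (inj₂ (sym d≡a , sym c≡b))

allPairs-lookup : ∀ {A : Set} {R : A → A → Set} → Symmetric R →
                  ∀ {xs} → AllPairs R xs → (p q : Fin (length xs)) → p ≢ q →
                  R (lookup xs p) (lookup xs q)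
allPairs-lookup symR (_ ∷ _)   zero    zero    p≢q = ⊥-elim (p≢q refl)
allPairs-lookup symR (Rx ∷ _)  zero    (suc q) _   = All.lookup Rx (∈-lookup q)
allPairs-lookup symR (Rx ∷ _)  (suc p) zero    _   = symR (All.lookup Rx (∈-lookup p))
allPairs-lookup symR (_ ∷ Rxs) (suc p) (suc q) p≢q =
  allPairs-lookup symR Rxs p q (p≢q ∘ cong suc)

last-All : ∀ {P : ℕ → Set} x xs → All P (x ∷ xs) → P (lastD (x ∷ xs))
last-All x []       (Px ∷ _)   = Px
last-All x (y ∷ ys) (_  ∷ Pys) = last-All y ys Pys

last-++ : ∀ x xs y ys → lastD (x ∷ xs ++ y ∷ ys) ≡ lastD (y ∷ ys)
last-++ x []       y ys = refl
last-++ x (z ∷ zs) y ys = last-++ z zs y ys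

last-map : ∀ (f : ℕ → ℕ) y ys → lastD (map f (y ∷ ys)) ≡ f (lastD (y ∷ ys))
last-map f y []       = refl
last-map f y (z ∷ zs) = last-map f z zs

dropLast-All : ∀ {P : ℕ → Set} xs → All P xs → All P (dropLast xs)
dropLast-All []           _          = []
dropLast-All (x ∷ [])     _          = []
dropLast-All (x ∷ y ∷ ys) (Px ∷ Pys) = Px ∷ dropLast-All (y ∷ ys) Pys

dropLast-AllPairs : ∀ {R : ℕ → ℕ → Set} xs → AllPairs R xs → AllPairs R (dropLast xs)
dropLast-AllPairs []           _          = []
dropLast-AllPairs (x ∷ [])     _          = []
dropLast-AllPairs (x ∷ y ∷ ys) (Rx ∷ Rys) =
  dropLast-All (y ∷ ys) Rx ∷ dropLast-AllPairs (y ∷ ys) Rys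

dropLast-≢-last : ∀ xs → AllPairs _≢_ xs → All (_≢ lastD xs) (dropLast xs)
dropLast-≢-last []           _          = []
dropLast-≢-last (x ∷ [])     _          = []
dropLast-≢-last (x ∷ y ∷ ys) (x∉ ∷ Rys) =
  last-All {λ z → x ≢ z} y ys x∉ ∷ dropLast-≢-last (y ∷ ys) Rys

-- The vertex renaming performed by `glue`: the root h of the second map is
-- identified with the marked vertex l of the first, and every other vertex x
-- of the second map becomes s + x, where s is the size of the first map.

relabel : ℕ → ℕ → ℕ → ℕ → ℕ
relabel s l h x = if x ≡ᵇ h then l else s + x

relabel-cases : ∀ s l h x → (x ≡ h × relabel s l h x ≡ l)
                          ⊎ (x ≢ h × relabel s l h x ≡ s + x)
relabel-cases s l h x with x ≡ᵇ h in eq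
... | true  = inj₁ (≡ᵇ⇒≡ x h (subst T (sym eq) tt) , refl)
... | false = inj₂ ((λ x≡h → subst T eq (≡⇒≡ᵇ x h x≡h)) , refl)

Within : ℕ → ℕ × ℕ → Set
Within s e = proj₁ e < s × proj₂ e < s

Loopless : ℕ × ℕ → Set
Loopless e = proj₁ e ≢ proj₂ e

module Relabel (s l h : ℕ) (l<s : l < s) where

  f : ℕ → ℕ
  f = relabel s l h

  g : ℕ × ℕ → ℕ × ℕ
  g e = f (proj₁ e) , f (proj₂ e)

  off-root-fresh : ∀ {x} → x ≢ h → s ≤ f x
  off-root-fresh {x} x≢h with relabel-cases s l h x
  ... | inj₁ (x≡h , _)    = ⊥-elim (x≢h x≡h)
  ... | inj₂ (_ , fx≡s+x) = subst (s ≤_) (sym fx≡s+x) (m≤m+n s x)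

  old-image-is-root : ∀ {x} → f x < s → x ≡ h × f x ≡ l
  old-image-is-root {x} fx<s with relabel-cases s l h x
  ... | inj₁ at-root    = at-root
  ... | inj₂ (x≢h , _) = ⊥-elim (<⇒≱ fx<s (off-root-fresh x≢h))

  old≢fresh : ∀ {x z} → x < s → z ≢ h → x ≢ f z
  old≢fresh x<s z≢h x≡fz = <⇒≱ x<s (subst (s ≤_) (sym x≡fz) (off-root-fresh z≢h))

  injective : ∀ {x y} → f x ≡ f y → x ≡ y
  injective {x} {y} fx≡fy with relabel-cases s l h x | relabel-cases s l h y
  ... | inj₁ (x≡h , _)    | inj₁ (y≡h , _)    = trans x≡h (sym y≡h)
  ... | inj₁ (_ , fx≡l)   | inj₂ (y≢h , _)    =
    ⊥-elim (old≢fresh l<s y≢h (trans (sym fx≡l) fx≡fy))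
  ... | inj₂ (x≢h , _)    | inj₁ (_ , fy≡l)   =
    ⊥-elim (old≢fresh l<s x≢h (trans (sym fy≡l) (sym fx≡fy)))
  ... | inj₂ (_ , fx≡s+x) | inj₂ (_ , fy≡s+y) =
    +-cancelˡ-≡ s x y (trans (sym fx≡s+x) (trans fx≡fy fy≡s+y))

  bounded : ∀ {t x} → x < t → f x < s + t
  bounded {t} {x} x<t with relabel-cases s l h x
  ... | inj₁ (_ , fx≡l)   = subst (_< s + t) (sym fx≡l) (<-≤-trans l<s (m≤m+n s t))
  ... | inj₂ (_ , fx≡s+x) = subst (_< s + t) (sym fx≡s+x) (+-monoʳ-< s x<t)

  g-loopless : ∀ {e} → Loopless e → Loopless (g e)
  g-loopless e-loopless = e-loopless ∘ injective

  g-reflects-parallel : ∀ e e′ → Parallel (g e) (g e′) → Parallel e e′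
  g-reflects-parallel (a , b) (c , d) (inj₁ (ac , bd)) = inj₁ (injective ac , injective bd)
  g-reflects-parallel (a , b) (c , d) (inj₂ (ad , bc)) = inj₂ (injective ad , injective bc)

  -- An edge among old vertices cannot be parallel to a renamed loopless
  -- edge: both endpoints of the latter would have to be the root h.
  old-edge-vs-renamed : ∀ {e e′} → Within s e → Loopless e′ → NonParallel e (g e′)
  old-edge-vs-renamed {a , b} {c , d} (a<s , b<s) c≢d (inj₁ (a≡fc , b≡fd)) =
    c≢d (trans (proj₁ (old-image-is-root (subst (_< s) a≡fc a<s)))
               (sym (proj₁ (old-image-is-root (subst (_< s) b≡fd b<s)))))
  old-edge-vs-renamed {a , b} {c , d} (a<s , b<s) c≢d (inj₂ (a≡fd , b≡fc)) =
    c≢d (trans (proj₁ (old-image-is-root (subst (_< s) b≡fc b<s)))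
               (sym (proj₁ (old-image-is-root (subst (_< s) a≡fd a<s)))))

record Simple (s : ℕ) (es : List (ℕ × ℕ)) (a : List ℕ) : Set where
  field
    edges-in     : All (Within s) es
    loopless     : All Loopless es
    nonparallel  : AllPairs NonParallel es
    arc-in       : All (_< s) a
    arc-distinct : AllPairs _≢_ a

data SimpleMap : BMap → Set where
  simpleMap : ∀ {s es r y ys} → Simple s es (r ∷ y ∷ ys) →
              SimpleMap (bmap s es (r ∷ y ∷ ys))

ClosingEdgeNew : BMap → Set
ClosingEdgeNew m = All (NonParallel (lastD (arc m) , headD (arc m))) (edges m)

HasSimpleMap : Tree → Set
HasSimpleMap t = SimpleMap (M t)

simple⇒noMultipleEdges : ∀ {m} → SimpleMap m → NoMultipleEdges (edges m)
simple⇒noMultipleEdges (simpleMap S) = allPairs-lookup NonParallel-sym (Simple.nonparallel S)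

module Ends {s es r y ys} (S : Simple s es (r ∷ y ∷ ys)) where
  open Simple S

  star : ℕ
  star = lastD (y ∷ ys)

  root<s : r < s
  root<s = All.head arc-in

  rest-in : All (_< s) (y ∷ ys)
  rest-in = All.tail arc-in

  star<s : star < s
  star<s = last-All y ys rest-in

  root∉rest : All (r ≢_) (y ∷ ys)
  root∉rest = AllPairs.head arc-distinct

  rest-distinct : AllPairs _≢_ (y ∷ ys)
  rest-distinct = AllPairs.tail arc-distinct

  root≢star : r ≢ star
  root≢star = last-All {r ≢_} y ys root∉rest

leaf-simple : SimpleMap leafMap
leaf-simple = simpleMap record
  { edges-in     = (z<s , s≤s z<s) ∷ []
  ; loopless     = (λ ()) ∷ []
  ; nonparallel  = [] ∷ []
  ; arc-in       = z<s ∷ s≤s z<s ∷ []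
  ; arc-distinct = ((λ ()) ∷ []) ∷ [] ∷ []
  }

module Gluing {s₁ s₂ es₁ es₂ r₁ y₁ ys₁ r₂ y₂ ys₂}
              (S₁ : Simple s₁ es₁ (r₁ ∷ y₁ ∷ ys₁)) (S₂ : Simple s₂ es₂ (r₂ ∷ y₂ ∷ ys₂)) where
  open Simple
  module E₁ = Ends S₁
  module E₂ = Ends S₂
  open Relabel s₁ E₁.star r₂ E₁.star<s

  weaken : ∀ {x} → x < s₁ → x < s₁ + s₂
  weaken x<s₁ = <-≤-trans x<s₁ (m≤m+n s₁ s₂)

  glued-edges : List (ℕ × ℕ)
  glued-edges = es₁ ++ map g es₂

  glued-arc : List ℕ
  glued-arc = r₁ ∷ y₁ ∷ ys₁ ++ map f (y₂ ∷ ys₂)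

  glued-edges-in : All (Within (s₁ + s₂)) glued-edges
  glued-edges-in =
    AllProps.++⁺ (All.map (λ { (a< , b<) → weaken a< , weaken b< }) (edges-in S₁))
                 (AllProps.map⁺ (All.map (λ { (a< , b<) → bounded a< , bounded b< }) (edges-in S₂)))

  glued-loopless : All Loopless glued-edges
  glued-loopless =
    AllProps.++⁺ (loopless S₁) (AllProps.map⁺ (All.map g-loopless (loopless S₂)))

  -- Old edges are pairwise fine, renamed ones because g reflects
  -- parallelism, and mixed pairs by old-edge-vs-renamed.
  glued-nonparallel : AllPairs NonParallel glued-edges
  glued-nonparallel = AllPairsProps.++⁺ (nonparallel S₁)
    (AllPairsProps.map⁺ (AllPairs.map (λ np → np ∘ g-reflects-parallel _ _) (nonparallel S₂)))
    (All.map (λ e-in → AllProps.map⁺ (All.map (old-edge-vs-renamed e-in) (loopless S₂)))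
             (edges-in S₁))

  glued-arc-in : All (_< s₁ + s₂) glued-arc
  glued-arc-in =
    AllProps.++⁺ (All.map weaken (arc-in S₁)) (AllProps.map⁺ (All.map bounded E₂.rest-in))

  -- The second arc loses its root r₂, so its remaining vertices are fresh.
  glued-arc-distinct : AllPairs _≢_ glued-arc
  glued-arc-distinct = AllPairsProps.++⁺ (arc-distinct S₁)
    (AllPairsProps.map⁺ (AllPairs.map (λ ne → ne ∘ injective) E₂.rest-distinct))
    (All.map (λ x<s₁ → AllProps.map⁺ (All.map (old≢fresh x<s₁ ∘ ≢-sym) E₂.root∉rest))
             (arc-in S₁))

  glued-simple : Simple (s₁ + s₂) glued-edges glued-arc
  glued-simple = record
    { edges-in     = glued-edges-in
    ; loopless     = glued-loopless
    ; nonparallel  = glued-nonparallel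
    ; arc-in       = glued-arc-in
    ; arc-distinct = glued-arc-distinct
    }

  star-glued : lastD (y₁ ∷ ys₁ ++ map f (y₂ ∷ ys₂)) ≡ f E₂.star
  star-glued = trans (last-++ y₁ ys₁ (f y₂) (map f ys₂)) (last-map f y₂ ys₂)

  -- r₁ is old and differs from ⋆₁, so it is not the image of any vertex.
  root≢renamed : ∀ x → r₁ ≢ f x
  root≢renamed x r₁≡fx =
    E₁.root≢star (trans r₁≡fx (proj₂ (old-image-is-root (subst (_< s₁) r₁≡fx E₁.root<s))))

  -- No edge joins the fresh vertex f ⋆₂ to r₁: the old edges have both ends
  -- old, and the renamed edges have no end equal to r₁.
  closing-new : All (NonParallel (f E₂.star , r₁)) glued-edges
  closing-new = AllProps.++⁺ (All.map old-edge (edges-in S₁))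
                             (AllProps.map⁺ (All.universal renamed-edge es₂))
    where
    star-fresh : ∀ {x} → x < s₁ → f E₂.star ≢ x
    star-fresh x<s₁ = ≢-sym (old≢fresh x<s₁ (≢-sym E₂.root≢star))

    old-edge : ∀ {e} → Within s₁ e → NonParallel (f E₂.star , r₁) e
    old-edge (a<s₁ , _) (inj₁ (star≡a , _)) = star-fresh a<s₁ star≡a
    old-edge (_ , b<s₁) (inj₂ (star≡b , _)) = star-fresh b<s₁ star≡b

    renamed-edge : ∀ e → NonParallel (f E₂.star , r₁) (g e)
    renamed-edge (c , d) (inj₁ (_ , r₁≡fd)) = root≢renamed d r₁≡fd
    renamed-edge (c , d) (inj₂ (_ , r₁≡fc)) = root≢renamed c r₁≡fc

  glued-closing-new : All (NonParallel (lastD (y₁ ∷ ys₁ ++ map f (y₂ ∷ ys₂)) , r₁)) glued-edges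
  glued-closing-new =
    subst (λ v → All (NonParallel (v , r₁)) glued-edges) (sym star-glued) closing-new

glue-simple : ∀ {A B} → SimpleMap A → SimpleMap B → SimpleMap (glue A B)
glue-simple (simpleMap S₁) (simpleMap S₂) = simpleMap (Gluing.glued-simple S₁ S₂)

glue-closing-new : ∀ {A B} → SimpleMap A → SimpleMap B → ClosingEdgeNew (glue A B)
glue-closing-new (simpleMap S₁) (simpleMap S₂) = Gluing.glued-closing-new S₁ S₂

close-simple : ∀ {m} j → SimpleMap m → ClosingEdgeNew m → SimpleMap (close (suc j) m)
close-simple j (simpleMap {y = y} {ys} S) new = simpleMap record
  { edges-in     = (star<s , root<s) ∷ edges-in
  ; loopless     = ≢-sym root≢star ∷ loopless
  ; nonparallel  = new ∷ nonparallel
  ; arc-in       = star<s ∷ root<s ∷ AllProps.take⁺ j (dropLast-All (y ∷ ys) rest-in)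
  ; arc-distinct = (≢-sym root≢star
                      ∷ All.map ≢-sym (AllProps.take⁺ j (dropLast-≢-last (y ∷ ys) rest-distinct)))
                   ∷ AllProps.take⁺ j (dropLast-All (y ∷ ys) root∉rest)
                   ∷ AllPairsProps.take⁺ j (dropLast-AllPairs (y ∷ ys) rest-distinct)
  }
  where
  open Simple S
  open Ends S

chain-simple : ∀ {acc} cs → SimpleMap acc → All HasSimpleMap cs → SimpleMap (chain acc cs)
chain-simple []       S []          = S
chain-simple (c ∷ cs) S (Sc ∷ Scs) = chain-simple cs (glue-simple S Sc) Scs

chain-closing-new : ∀ {acc} c cs → SimpleMap acc → All HasSimpleMap (c ∷ cs) →
                    ClosingEdgeNew (chain acc (c ∷ cs))
chain-closing-new c []        S (Sc ∷ [])  = glue-closing-new S Sc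
chain-closing-new c (c′ ∷ cs) S (Sc ∷ Scs) = chain-closing-new c′ cs (glue-simple S Sc) Scs

node-simple : ∀ {i} cs → 1 ≤ i → (cs ≢ [] → 2 ≤ length cs) → All HasSimpleMap cs →
              HasSimpleMap (node i cs)
node-simple []       _ _ _ = leaf-simple
node-simple (c ∷ []) _ branching _ with branching (λ ())
... | s≤s ()
node-simple {suc j} (c ∷ c′ ∷ cs) (s≤s z≤n) _ (Sc ∷ Scs) =
  close-simple j (chain-simple (c′ ∷ cs) Sc Scs) (chain-closing-new c′ cs Sc Scs)

mutual
  nonRoot-simple : ∀ {t} → NonRootOK t → EveryNonRootHasSibling t → HasSimpleMap t
  nonRoot-simple (leafOK _)           _                  = leaf-simple
  nonRoot-simple (innerOK pos _ ok) (sib branching sibs) =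
    node-simple _ pos branching (all-nonRoot-simple ok sibs)

  all-nonRoot-simple : ∀ {cs} → All NonRootOK cs → All EveryNonRootHasSibling cs →
                       All HasSimpleMap cs
  all-nonRoot-simple []       []       = []
  all-nonRoot-simple (o ∷ os) (s ∷ ss) = nonRoot-simple o s ∷ all-nonRoot-simple os ss

-- The root is handled like any other node: only positivity of its label and
-- the branching condition are needed.
lemma3 : (T : Tree) → IsBeta10 T → EveryNonRootHasSibling T →
    NoMultipleEdges (Φ T)
lemma3 (node i cs) (rootOK pos _ _ ok) (sib branching sibs) =
  simple⇒noMultipleEdges (node-simple cs pos branching (all-nonRoot-simple ok sibs))
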